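{- Let $q=p^m$ with $p$ an odd prime, $q\equiv 1\pmod 3$ and $q\ge 13$. Let $\pi,\sigma\in PGL(2,q)$ be of the form $\pi(x)=a+\frac{r}{x-i}$, $\sigma(x)=b+\frac{s}{x-j}$ with $a,b,i,j,r,s\in GF(q)$, $r,s\neq 0$. Then $hd(\pi^{\triangle},\sigma^{\triangle})=hd(\pi,\sigma)-3$ if and only if $\pi\sigma$ is an edge of $C_P(q)$.
   Context: $PGL(2,q)$ is the group of maps $x\mapsto\frac{ax+b}{cx+d}$ ($ad\neq bc$) acting on $GF(q)\cup\{\infty\}$ with the usual conventions ($-d/c\mapsto\infty$, $\infty\mapsto a/c$ if $c\neq0$, $\infty\mapsto\infty$ if $c=0$). The function $a+\frac{r}{x-i}$ ($r\ne0$) maps $x\notin\{i,\infty\}$ to $a+r(x-i)^{ -1}$, $\infty\mapsto a$, $i\mapsto\infty$. For permutations $\pi,\sigma$, $hd(\pi,\sigma)=|\{x:\pi(x)\neq\sigma(x)\}|$. With distinguished element $\infty$, $\pi^{\triangle}$ is defined by $\pi^{\triangle}(\pi^{ -1}(\infty))=\pi(\infty)$, $\pi^{\triangle}(\infty)=\infty$, $\pi^{\triangle}(x)=\pi(x)$ otherwise. The contraction graph $C_P(q)$ has vertex set $PGL(2,q)$, with distinct $\pi,\sigma$ adjacent iff $hd(\pi^{\triangle},\sigma^{\triangle})=q-4$. -}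

module Defs where

open import Level using (0ℓ)
open import Data.Nat using (ℕ; zero; suc) renaming (_+_ to _+ℕ_)
open import Data.Fin using (Fin)
open import Data.List using (List; []; _∷_; map; filter; length; allFin)
open import Data.Maybe using (Maybe; just; nothing)
import Data.Maybe.Properties as MaybeP
open import Data.Product using (Σ; _×_; _,_; proj₁)
open import Relation.Nullary using (¬_; Dec; yes; no; ¬?)
open import Relation.Binary.PropositionalEquality using (_≡_)
open import Relation.Binary.Definitions using (DecidableEquality)
open import Algebra.Structures using (IsCommutativeRing)
open import Function.Bundles using (_↔_; Inverse)

record FiniteField (q : ℕ) : Set₁ where
  infixl 6 _+_ _-_
  infixl 7 _*_
  field
    F      : Set
    _+_    : F → F → F
    _*_    : F → F → F
    -_     : F → F
    0#     : F
    1#     : F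
    isCommutativeRing : IsCommutativeRing _≡_ _+_ _*_ -_ 0# 1#
    0≢1    : ¬ (0# ≡ 1#)
    inverse : (x : F) → ¬ (x ≡ 0#) → Σ F (λ y → x * y ≡ 1#)
    _≟_    : DecidableEquality F
    card   : F ↔ Fin q

  _-_ : F → F → F
  x - y = x + (- y)

  -- total inverse (0⁻¹ := 0, only ever used on nonzero arguments)
  _⁻¹ : F → F
  x ⁻¹ with x ≟ 0#
  ... | yes _ = 0#
  ... | no x≢0 = proj₁ (inverse x x≢0)

  -- projective line GF(q) ∪ {∞}; nothing = ∞
  P1 : Set
  P1 = Maybe F

  ∞ : P1
  ∞ = nothing

  _≟P_ : DecidableEquality P1
  _≟P_ = MaybeP.≡-dec _≟_

  points : List P1
  points = ∞ ∷ map (λ k → just (Inverse.from card k)) (allFin q)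

  hd : (P1 → P1) → (P1 → P1) → ℕ
  hd π σ = length (filter (λ x → ¬? (π x ≟P σ x)) points)

  mob : F → F → F → F → P1 → P1
  mob a b c d nothing with c ≟ 0#
  ... | yes _ = ∞
  ... | no _  = just (a * (c ⁻¹))
  mob a b c d (just x) with (c * x + d) ≟ 0#
  ... | yes _ = ∞
  ... | no _  = just ((a * x + b) * ((c * x + d) ⁻¹))

  InPGL : (P1 → P1) → Set
  InPGL π = Σ F λ a → Σ F λ b → Σ F λ c → Σ F λ d →
              ¬ (a * d ≡ b * c) × ((x : P1) → π x ≡ mob a b c d x)

  frac : F → F → F → P1 → P1
  frac a r i nothing = just a
  frac a r i (just x) with x ≟ i
  ... | yes _ = ∞
  ... | no _  = just (a + r * ((x - i) ⁻¹))

  tri : (P1 → P1) → P1 → P1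
  tri π nothing = ∞
  tri π (just x) with π (just x) ≟P ∞
  ... | yes _ = π ∞
  ... | no _  = π (just x)

  Edge : (P1 → P1) → (P1 → P1) → Set
  Edge π σ = InPGL π × InPGL σ × ¬ ((x : P1) → π x ≡ σ x)
             × (hd (tri π) (tri σ) +ℕ 4 ≡ q)

-- Off the poles i, j the maps π = a + r/(x - i), σ = b + s/(x - j) coincide with their contractions,
-- and π x = σ x there exactly when x is a root of the quadratic
--   Q(x) = (a - b)(x - i)(x - j) + r(x - j) - s(x - i),
-- which has at most two roots unless all its coefficients vanish. Compare the contributions of ∞, i, j.
-- If i = j, then hd(π△, σ△) = hd(π, σ), and π△, σ△ agree at most twice on GF(q) unless π = σ, while an
-- edge needs four agreements: neither side holds.
-- If i ≠ j, the drop by 3 means exactly a = σ(i) and π(j) = b (which forces a ≠ b), and being an edge means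
-- that π, σ agree at 2 + [a ≠ σ(i)] + [π(j) ≠ b] points of GF(q). Since Q(i), Q(j) ≠ 0 there are at most
-- two agreements, so an edge gives a = σ(i), π(j) = b. Conversely these say r = s = (a - b)e with e = i - j,
-- so Q(x) = (a - b)(y² + ey + e²) with y = x - i, which has the two roots y = eω, eω² for a primitive cube
-- root of unity ω. It exists because q ≡ 1 (mod 3): otherwise x ↦ 1/(1 - x), of order 3 and without fixed
-- points on GF(q) ∖ {0, 1}, would give 3 ∣ q - 2. Likewise ω ≠ ω², i.e. 1 + 1 + 1 ≠ 0, since otherwise the
-- translation x ↦ x + 1 would give 3 ∣ q.

module Submission where

open import Level using (0ℓ)
open import Algebra.Bundles using (CommutativeRing)
import Algebra.Solver.Ring as RingSolver
open import Algebra.Solver.Ring.AlmostCommutativeRing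
  using (fromCommutativeRing; _-Raw-AlmostCommutative⟶_)
open import Data.Empty using (⊥; ⊥-elim)
open import Data.Unit using (⊤; tt)
open import Data.List using (List; []; _∷_; map; filter; length; allFin)
import Data.List.Properties as List
open import Data.List.Membership.Propositional using (_∈_)
open import Data.List.Membership.Propositional.Properties using (∈-map⁺; ∈-allFin)
open import Data.List.Relation.Unary.All as All using (All; []; _∷_)
open import Data.List.Relation.Unary.Any as Any using (here; there)
open import Data.List.Relation.Unary.Unique.Propositional using (Unique; _∷_)
open import Data.List.Relation.Unary.Unique.Propositional.Properties using (map⁺; allFin⁺)
open import Data.Integer as ℤ using (ℤ; -[1+_]; _⊖_; _◃_; sign; ∣_∣)
import Data.Integer.Properties as ℤ
import Data.Maybe.Base as Maybe
open import Data.Maybe.Base using (just; nothing)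
open import Data.Maybe.Properties using (just-injective)
open import Data.Nat as ℕ using (ℕ; zero; suc; _≤_; _%_; z≤n; s≤s)
open import Data.Nat.Primality using (Prime)
import Data.Nat.Properties as ℕ
open import Data.Nat.Divisibility using (_∣_; divides; ∣-refl; ∣m∣n⇒∣m+n; n∣m⇒m%n≡0)
open import Data.Nat.DivMod using ([m+kn]%n≡m%n)
open import Data.Nat.ListAction using (sum)
open import Data.Product using (Σ; _×_; _,_; proj₁; proj₂)
open import Data.Sign as Sign using (Sign)
import Data.Sum
open Data.Sum using (_⊎_; inj₁; inj₂; [_,_]′)
open import Function using (_∘_; _⇔_; mk⇔; Equivalence; Inverse)
open import Function.Properties.Equivalence using () renaming (trans to ⇔-trans)
open import Relation.Binary.Consequences using (dec⇒weaklyDec)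
import Relation.Binary.PropositionalEquality as ≡
open import Relation.Nullary using (¬_; Dec; yes; no; ¬?)
open import Relation.Nullary.Decidable using (_×-dec_)
open import Relation.Unary using (Pred; Decidable)
open import Defs

module IntegerCoefficientRingSolver {c ℓ} (R : CommutativeRing c ℓ) where
  open CommutativeRing R
  open import Algebra.Properties.Ring ring
    using (-0#≈0#; -‿involutive; -‿+-comm; -1*x≈-x)
  open import Algebra.Properties.Semiring.Mult.TCOptimised semiring
    using (×-homo-+; ×1-homo-*; 1+×) renaming (_×_ to _×ₙ_)
  open import Algebra.Properties.CommutativeSemigroup +-commutativeSemigroup
    using () renaming (interchange to +-interchange)
  open import Algebra.Properties.CommutativeSemigroup *-commutativeSemigroup
    using () renaming (interchange to *-interchange)
  open import Relation.Binary.Reasoning.Setoid setoid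

  ⟦_⟧ : ℤ → Carrier
  ⟦ ℤ.+ n ⟧    = n ×ₙ 1#
  ⟦ -[1+ n ] ⟧ = - (suc n ×ₙ 1#)

  ⟦_⟧ₛ : Sign → Carrier
  ⟦ Sign.+ ⟧ₛ = 1#
  ⟦ Sign.- ⟧ₛ = - 1#

  ⟦⊖⟧ : ∀ m n → ⟦ m ⊖ n ⟧ ≈ m ×ₙ 1# - n ×ₙ 1#
  ⟦⊖⟧ m zero = begin
    ⟦ m ⊖ 0 ⟧        ≡⟨ ≡.cong ⟦_⟧ (ℤ.⊖-≥ {m} z≤n) ⟩
    m ×ₙ 1#           ≈⟨ +-identityʳ _ ⟨
    m ×ₙ 1# + 0#      ≈⟨ +-congˡ -0#≈0# ⟨
    m ×ₙ 1# - 0 ×ₙ 1#  ∎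
  ⟦⊖⟧ zero (suc n) = sym (+-identityˡ _)
  ⟦⊖⟧ (suc m) (suc n) = begin
    ⟦ suc m ⊖ suc n ⟧                ≡⟨ ≡.cong ⟦_⟧ (ℤ.[1+m]⊖[1+n]≡m⊖n m n) ⟩
    ⟦ m ⊖ n ⟧                        ≈⟨ ⟦⊖⟧ m n ⟩
    m ×ₙ 1# - n ×ₙ 1#                  ≈⟨ +-identityˡ _ ⟨
    0# + (m ×ₙ 1# - n ×ₙ 1#)           ≈⟨ +-congʳ (-‿inverseʳ 1#) ⟨
    (1# - 1#) + (m ×ₙ 1# - n ×ₙ 1#)    ≈⟨ +-interchange 1# (- 1#) (m ×ₙ 1#) (- (n ×ₙ 1#)) ⟩
    (1# + m ×ₙ 1#) + (- 1# - n ×ₙ 1#)  ≈⟨ +-congˡ (-‿+-comm 1# (n ×ₙ 1#)) ⟩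
    (1# + m ×ₙ 1#) - (1# + n ×ₙ 1#)    ≈⟨ +-cong (1+× m 1#) (-‿cong (1+× n 1#)) ⟨
    suc m ×ₙ 1# - suc n ×ₙ 1#          ∎

  +-homo : ∀ x y → ⟦ x ℤ.+ y ⟧ ≈ ⟦ x ⟧ + ⟦ y ⟧
  +-homo (ℤ.+ m)    (ℤ.+ n)    = ×-homo-+ 1# m n
  +-homo (ℤ.+ m)    -[1+ n ] = ⟦⊖⟧ m (suc n)
  +-homo -[1+ m ] (ℤ.+ n)    = trans (⟦⊖⟧ n (suc m)) (+-comm _ _)
  +-homo -[1+ m ] -[1+ n ] = begin
    - (suc (suc (m ℕ.+ n)) ×ₙ 1#)     ≡⟨ ≡.cong (λ k → - (suc k ×ₙ 1#)) (ℕ.+-suc m n) ⟨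
    - ((suc m ℕ.+ suc n) ×ₙ 1#)       ≈⟨ -‿cong (×-homo-+ 1# (suc m) (suc n)) ⟩
    - (suc m ×ₙ 1# + suc n ×ₙ 1#)      ≈⟨ -‿+-comm _ _ ⟨
    - (suc m ×ₙ 1#) + - (suc n ×ₙ 1#)  ∎

  -‿homo : ∀ x → ⟦ ℤ.- x ⟧ ≈ - ⟦ x ⟧
  -‿homo -[1+ n ]  = sym (-‿involutive _)
  -‿homo (ℤ.+ zero)  = sym -0#≈0#
  -‿homo (ℤ.+ suc n) = refl

  ⟦◃⟧ : ∀ s n → ⟦ s ◃ n ⟧ ≈ ⟦ s ⟧ₛ * (n ×ₙ 1#)
  ⟦◃⟧ s      zero    = sym (zeroʳ _)
  ⟦◃⟧ Sign.+ (suc n) = sym (*-identityˡ _)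
  ⟦◃⟧ Sign.- (suc n) = sym (-1*x≈-x _)

  ⟦*⟧ₛ : ∀ s t → ⟦ s Sign.* t ⟧ₛ ≈ ⟦ s ⟧ₛ * ⟦ t ⟧ₛ
  ⟦*⟧ₛ Sign.+ t      = sym (*-identityˡ _)
  ⟦*⟧ₛ Sign.- Sign.+ = sym (*-identityʳ _)
  ⟦*⟧ₛ Sign.- Sign.- = sym (trans (-1*x≈-x (- 1#)) (-‿involutive 1#))

  ⟦sign◃∣∣⟧ : ∀ x → ⟦ x ⟧ ≈ ⟦ sign x ⟧ₛ * (∣ x ∣ ×ₙ 1#)
  ⟦sign◃∣∣⟧ x = trans (reflexive (≡.cong ⟦_⟧ (≡.sym (ℤ.◃-inverse x)))) (⟦◃⟧ (sign x) ∣ x ∣)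

  *-homo : ∀ x y → ⟦ x ℤ.* y ⟧ ≈ ⟦ x ⟧ * ⟦ y ⟧
  *-homo x y = begin
    ⟦ (sign x Sign.* sign y) ◃ (∣ x ∣ ℕ.* ∣ y ∣) ⟧
      ≈⟨ ⟦◃⟧ (sign x Sign.* sign y) (∣ x ∣ ℕ.* ∣ y ∣) ⟩
    ⟦ sign x Sign.* sign y ⟧ₛ * ((∣ x ∣ ℕ.* ∣ y ∣) ×ₙ 1#)
      ≈⟨ *-cong (⟦*⟧ₛ (sign x) (sign y)) (×1-homo-* ∣ x ∣ ∣ y ∣) ⟩
    (⟦ sign x ⟧ₛ * ⟦ sign y ⟧ₛ) * ((∣ x ∣ ×ₙ 1#) * (∣ y ∣ ×ₙ 1#))
      ≈⟨ *-interchange _ _ _ _ ⟩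
    (⟦ sign x ⟧ₛ * (∣ x ∣ ×ₙ 1#)) * (⟦ sign y ⟧ₛ * (∣ y ∣ ×ₙ 1#))
      ≈⟨ *-cong (⟦sign◃∣∣⟧ x) (⟦sign◃∣∣⟧ y) ⟨
    ⟦ x ⟧ * ⟦ y ⟧ ∎

  homomorphism : CommutativeRing.rawRing ℤ.+-*-commutativeRing
                   -Raw-AlmostCommutative⟶ fromCommutativeRing R
  homomorphism = record
    { ⟦_⟧ = ⟦_⟧ ; +-homo = +-homo ; *-homo = *-homo ; -‿homo = -‿homo
    ; 0-homo = refl ; 1-homo = refl }

  ⟦⟧-≟ : ∀ m n → Maybe.Maybe (⟦ m ⟧ ≈ ⟦ n ⟧)
  ⟦⟧-≟ m n = Maybe.map (λ { ≡.refl → refl }) (dec⇒weaklyDec ℤ._≟_ m n)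

  open RingSolver _ _ homomorphism ⟦⟧-≟ public
    using (solve; _:=_; _:+_; _:*_; :-_; _:-_; con; Polynomial)

  :0 :1 : ∀ {n} → Polynomial n
  :0 = con (ℤ.+ 0)
  :1 = con (ℤ.+ 1)

open ≡ using (_≡_; _≢_; refl; sym; trans; cong; cong₂; subst; module ≡-Reasoning)

_when_ : {A : Set} → ℕ → Dec A → ℕ
n when yes _ = n
n when no _  = 0

𝟙 : {A : Set} → Dec A → ℕ
𝟙 d = 1 when d

𝟙-yes : {A : Set} → A → (d : Dec A) → 𝟙 d ≡ 1
𝟙-yes a (yes _) = refl
𝟙-yes a (no ¬a) = ⊥-elim (¬a a)

𝟙-no : {A : Set} → ¬ A → (d : Dec A) → 𝟙 d ≡ 0
𝟙-no ¬a (yes a) = ⊥-elim (¬a a)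
𝟙-no ¬a (no _)  = refl

𝟙≤1 : {A : Set} (d : Dec A) → 𝟙 d ≤ 1
𝟙≤1 (yes _) = s≤s z≤n
𝟙≤1 (no _)  = z≤n

𝟙-cong : {A B : Set} → (A → B) → (B → A) → (d : Dec A) (e : Dec B) → 𝟙 d ≡ 𝟙 e
𝟙-cong f g (yes a) e = sym (𝟙-yes (f a) e)
𝟙-cong f g (no ¬a) e = sym (𝟙-no (¬a ∘ g) e)

𝟙-¬?+𝟙 : {A : Set} (d : Dec A) → 𝟙 (¬? d) ℕ.+ 𝟙 d ≡ 1
𝟙-¬?+𝟙 (yes _) = refl
𝟙-¬?+𝟙 (no _)  = refl

module _ {A : Set} where
  open import Algebra.Properties.CommutativeSemigroup ℕ.+-commutativeSemigroup
    using () renaming (interchange to +-interchange)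

  sum-map-+ : ∀ (f g : A → ℕ) xs → sum (map (λ x → f x ℕ.+ g x) xs) ≡ sum (map f xs) ℕ.+ sum (map g xs)
  sum-map-+ f g []       = refl
  sum-map-+ f g (x ∷ xs) = trans (cong (f x ℕ.+ g x ℕ.+_) (sum-map-+ f g xs))
                                 (+-interchange (f x) (g x) (sum (map f xs)) (sum (map g xs)))

  length-filter≡sum-𝟙 : ∀ {P : Pred A 0ℓ} (P? : Decidable P) xs →
                        length (filter P? xs) ≡ sum (map (λ x → 𝟙 (P? x)) xs)
  length-filter≡sum-𝟙 P? []       = refl
  length-filter≡sum-𝟙 P? (x ∷ xs) with P? x
  ... | yes _ = cong suc (length-filter≡sum-𝟙 P? xs)
  ... | no _  = length-filter≡sum-𝟙 P? xs

  sum-map-point : ∀ {f : A → ℕ} {u xs} → Unique xs → u ∈ xs →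
                  (∀ x → x ≢ u → f x ≡ 0) → sum (map f xs) ≡ f u
  sum-map-point {f} (u∉xs ∷ _) (here refl) f≡0 =
    trans (cong (f _ ℕ.+_) (sum-zero u∉xs)) (ℕ.+-identityʳ _)
    where
    sum-zero : ∀ {ys} → All (_ ≢_) ys → sum (map f ys) ≡ 0
    sum-zero []             = refl
    sum-zero (u≢y ∷ u≢ys) = cong₂ ℕ._+_ (f≡0 _ (u≢y ∘ sym)) (sum-zero u≢ys)
  sum-map-point (x∉xs ∷ xs-unique) (there u∈xs) f≡0 =
    cong₂ ℕ._+_ (f≡0 _ (All.lookup x∉xs u∈xs)) (sum-map-point xs-unique u∈xs f≡0)

+-rebalance : ∀ {d m t} k n → d ℕ.+ m ≡ t ℕ.+ 2 → t ℕ.+ (k ℕ.+ 2) ≡ d ℕ.+ n ⇔ m ℕ.+ k ≡ n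
+-rebalance {d} {m} {t} k n d+m≡t+2 = mk⇔
  (λ eq → ℕ.+-cancelˡ-≡ d _ _ (trans (sym shift) eq))
  (λ eq → trans shift (cong (d ℕ.+_) eq))
  where
  shift : t ℕ.+ (k ℕ.+ 2) ≡ d ℕ.+ (m ℕ.+ k)
  shift = begin
    t ℕ.+ (k ℕ.+ 2)    ≡⟨ cong (t ℕ.+_) (ℕ.+-comm k 2) ⟩
    t ℕ.+ (2 ℕ.+ k)    ≡⟨ ℕ.+-assoc t 2 k ⟨
    t ℕ.+ 2 ℕ.+ k      ≡⟨ cong (ℕ._+ k) d+m≡t+2 ⟨
    d ℕ.+ m ℕ.+ k      ≡⟨ ℕ.+-assoc d m k ⟩
    d ℕ.+ (m ℕ.+ k)    ∎
    where open ≡-Reasoning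

m+n+o≤o⇒m≡0×n≡0 : ∀ m n {o} → m ℕ.+ n ℕ.+ o ≤ o → m ≡ 0 × n ≡ 0
m+n+o≤o⇒m≡0×n≡0 m n {o} m+n+o≤o = ℕ.m+n≡0⇒m≡0 m m+n≡0 , ℕ.m+n≡0⇒n≡0 m m+n≡0
  where
  m+n≡0 : m ℕ.+ n ≡ 0
  m+n≡0 = ℕ.n≤0⇒n≡0 (ℕ.+-cancelʳ-≤ o (m ℕ.+ n) 0 m+n+o≤o)

module FieldProperties {q : ℕ} (K : FiniteField q) where
  open FiniteField K
  open ≡-Reasoning

  commutativeRing : CommutativeRing 0ℓ 0ℓ
  commutativeRing = record { isCommutativeRing = isCommutativeRing }

  open CommutativeRing commutativeRing public
    using (+-identityˡ; +-identityʳ; -‿inverseʳ;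
           *-comm; *-assoc; *-identityˡ; *-identityʳ; zeroˡ; zeroʳ)
  open import Algebra.Properties.Ring (CommutativeRing.ring commutativeRing) public
    using (+-cancelʳ) renaming (x∙y⁻¹≈ε⇒x≈y to x-y≡0⇒x≡y)
  open IntegerCoefficientRingSolver commutativeRing public

  x≡y⇒x-y≡0 : ∀ {x y} → x ≡ y → x - y ≡ 0#
  x≡y⇒x-y≡0 refl = -‿inverseʳ _

  x≢y⇒x-y≢0 : ∀ {x y} → x ≢ y → x - y ≢ 0#
  x≢y⇒x-y≢0 x≢y = x≢y ∘ x-y≡0⇒x≡y _ _

  1≢0 : 1# ≢ 0#
  1≢0 = 0≢1 ∘ sym

  ⁻¹-inverseʳ : ∀ {x} → x ≢ 0# → x * x ⁻¹ ≡ 1#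
  ⁻¹-inverseʳ {x} x≢0 with x ≟ 0#
  ... | yes x≡0 = ⊥-elim (x≢0 x≡0)
  ... | no x≢0′ = proj₂ (inverse x x≢0′)

  ⁻¹-inverseˡ : ∀ {x} → x ≢ 0# → x ⁻¹ * x ≡ 1#
  ⁻¹-inverseˡ x≢0 = trans (*-comm _ _) (⁻¹-inverseʳ x≢0)

  1⁻¹≡1 : 1# ⁻¹ ≡ 1#
  1⁻¹≡1 = trans (sym (*-identityˡ _)) (⁻¹-inverseʳ 1≢0)

  ⁻¹*[x*y]≡y : ∀ {x y} → x ≢ 0# → x ⁻¹ * (x * y) ≡ y
  ⁻¹*[x*y]≡y {x} {y} x≢0 = begin
    x ⁻¹ * (x * y)  ≡⟨ *-assoc _ _ _ ⟨
    x ⁻¹ * x * y    ≡⟨ cong (_* y) (⁻¹-inverseˡ x≢0) ⟩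
    1# * y          ≡⟨ *-identityˡ y ⟩
    y               ∎

  ⁻¹-unique : ∀ {y z} → y ≢ 0# → y * z ≡ 1# → y ⁻¹ ≡ z
  ⁻¹-unique {y} {z} y≢0 yz≡1 = begin
    y ⁻¹             ≡⟨ *-identityʳ _ ⟨
    y ⁻¹ * 1#        ≡⟨ cong (y ⁻¹ *_) yz≡1 ⟨
    y ⁻¹ * (y * z)   ≡⟨ ⁻¹*[x*y]≡y y≢0 ⟩
    z                ∎

  *-cancelˡ : ∀ {c x y} → c ≢ 0# → c * x ≡ c * y → x ≡ y
  *-cancelˡ {c} c≢0 cx≡cy =
    trans (sym (⁻¹*[x*y]≡y c≢0)) (trans (cong (c ⁻¹ *_) cx≡cy) (⁻¹*[x*y]≡y c≢0))

  *-cancelˡ-≡0 : ∀ {c x} → c ≢ 0# → c * x ≡ 0# → x ≡ 0#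
  *-cancelˡ-≡0 {c} c≢0 cx≡0 = *-cancelˡ c≢0 (trans cx≡0 (sym (zeroʳ c)))

  x*y≡0⇒x≡0⊎y≡0 : ∀ {x y} → x * y ≡ 0# → x ≡ 0# ⊎ y ≡ 0#
  x*y≡0⇒x≡0⊎y≡0 {x} xy≡0 with x ≟ 0#
  ... | yes x≡0 = inj₁ x≡0
  ... | no x≢0  = inj₂ (*-cancelˡ-≡0 x≢0 xy≡0)

  *-≢0 : ∀ {x y} → x ≢ 0# → y ≢ 0# → x * y ≢ 0#
  *-≢0 x≢0 y≢0 xy≡0 = [ x≢0 , y≢0 ]′ (x*y≡0⇒x≡0⊎y≡0 xy≡0)

  ⁻¹-≢0 : ∀ {x} → x ≢ 0# → x ⁻¹ ≢ 0#
  ⁻¹-≢0 {x} x≢0 x⁻¹≡0 = 1≢0 (begin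
    1#          ≡⟨ ⁻¹-inverseʳ x≢0 ⟨
    x * x ⁻¹    ≡⟨ cong (x *_) x⁻¹≡0 ⟩
    x * 0#      ≡⟨ zeroʳ x ⟩
    0#          ∎)

  x≡y+z/w⇒z≡[x-y]w : ∀ {x y z w} → w ≢ 0# → x ≡ y + z * w ⁻¹ → z ≡ (x - y) * w
  x≡y+z/w⇒z≡[x-y]w {x} {y} {z} {w} w≢0 x≡y+z/w = sym (begin
    (x - y) * w                ≡⟨ cong (λ t → (t - y) * w) x≡y+z/w ⟩
    (y + z * w ⁻¹ - y) * w
      ≡⟨ solve 4 (λ y z w W → (y :+ z :* W :- y) :* w := z :* (W :* w)) refl y z w (w ⁻¹) ⟩
    z * (w ⁻¹ * w)             ≡⟨ cong (z *_) (⁻¹-inverseˡ w≢0) ⟩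
    z * 1#                     ≡⟨ *-identityʳ z ⟩
    z                          ∎)

  a+r/u≡b+s/w⇔ : ∀ {a b r s u w} → u ≢ 0# → w ≢ 0# →
                 a + r * u ⁻¹ ≡ b + s * w ⁻¹ ⇔ (a - b) * (u * w) + (r * w - s * u) ≡ 0#
  a+r/u≡b+s/w⇔ {a} {b} {r} {s} {u} {w} u≢0 w≢0 = mk⇔
    (λ eq → trans (sym cleared) (trans (cong (_* (u * w)) (x≡y⇒x-y≡0 eq)) (zeroˡ _)))
    (λ eq → x-y≡0⇒x≡y _ _ (*-cancelˡ-≡0 (*-≢0 u≢0 w≢0) (trans (*-comm _ _) (trans cleared eq))))
    where
    cleared : (a + r * u ⁻¹ - (b + s * w ⁻¹)) * (u * w) ≡ (a - b) * (u * w) + (r * w - s * u)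
    cleared = begin
      (a + r * u ⁻¹ - (b + s * w ⁻¹)) * (u * w)
        ≡⟨ solve 8 (λ a b r s u w U W →
             (a :+ r :* U :- (b :+ s :* W)) :* (u :* w)
               := (a :- b) :* (u :* w) :+ (r :* (u :* U) :* w :- s :* (w :* W) :* u))
             refl a b r s u w (u ⁻¹) (w ⁻¹) ⟩
      (a - b) * (u * w) + (r * (u * u ⁻¹) * w - s * (w * w ⁻¹) * u)
        ≡⟨ cong₂ (λ U W → (a - b) * (u * w) + (r * U * w - s * W * u))
                 (⁻¹-inverseʳ u≢0) (⁻¹-inverseʳ w≢0) ⟩
      (a - b) * (u * w) + (r * 1# * w - s * 1# * u)
        ≡⟨ cong₂ (λ r′ s′ → (a - b) * (u * w) + (r′ * w - s′ * u)) (*-identityʳ r) (*-identityʳ s) ⟩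
      (a - b) * (u * w) + (r * w - s * u) ∎

  root-of-product⇔ : ∀ {c x u v} → c ≢ 0# → c * ((x - u) * (x - v)) ≡ 0# ⇔ (x ≡ u ⊎ x ≡ v)
  root-of-product⇔ {c} {x} {u} {v} c≢0 = mk⇔
    (λ eq → Data.Sum.map (x-y≡0⇒x≡y _ _) (x-y≡0⇒x≡y _ _) (x*y≡0⇒x≡0⊎y≡0 (*-cancelˡ-≡0 c≢0 eq)))
    [ (λ { refl → solve 3 (λ c x v → c :* ((x :- x) :* (x :- v)) := :0) refl c x v })
    , (λ { refl → solve 3 (λ c x u → c :* ((x :- u) :* (x :- x)) := :0) refl c x u }) ]′

  quadratic : F → F → F → F → F
  quadratic A B C x = (A * x + B) * x + C

  three-roots⇒coefficients≡0 : ∀ {A B C x y z} → x ≢ y → x ≢ z → y ≢ z →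
    quadratic A B C x ≡ 0# → quadratic A B C y ≡ 0# → quadratic A B C z ≡ 0# →
    A ≡ 0# × B ≡ 0# × C ≡ 0#
  three-roots⇒coefficients≡0 {A} {B} {C} {x} {y} {z} x≢y x≢z y≢z qx qy qz = A≡0 , B≡0 , C≡0
    where
    slope : F → F → F
    slope u v = A * (u + v) + B

    slope≡0 : ∀ {u v} → u ≢ v → quadratic A B C u ≡ 0# → quadratic A B C v ≡ 0# → slope u v ≡ 0#
    slope≡0 {u} {v} u≢v qu qv = *-cancelˡ-≡0 (x≢y⇒x-y≢0 u≢v) (begin
      (u - v) * slope u v
        ≡⟨ solve 5 (λ A B C u v → (u :- v) :* (A :* (u :+ v) :+ B)
                      := (A :* u :+ B) :* u :+ C :- ((A :* v :+ B) :* v :+ C)) refl A B C u v ⟩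
      quadratic A B C u - quadratic A B C v  ≡⟨ x≡y⇒x-y≡0 (trans qu (sym qv)) ⟩
      0#                                     ∎)

    A≡0 : A ≡ 0#
    A≡0 = *-cancelˡ-≡0 (x≢y⇒x-y≢0 y≢z) (begin
      (y - z) * A
        ≡⟨ solve 5 (λ A B x y z → (y :- z) :* A
                      := A :* (x :+ y) :+ B :- (A :* (x :+ z) :+ B)) refl A B x y z ⟩
      slope x y - slope x z  ≡⟨ x≡y⇒x-y≡0 (trans (slope≡0 x≢y qx qy) (sym (slope≡0 x≢z qx qz))) ⟩
      0#                     ∎)

    B≡0 : B ≡ 0#
    B≡0 = begin
      B                        ≡⟨ solve 3 (λ A B t → B := A :* t :+ B :- A :* t) refl A B (x + y) ⟩
      slope x y - A * (x + y)  ≡⟨ cong₂ (λ l a → l - a * (x + y)) (slope≡0 x≢y qx qy) A≡0 ⟩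
      0# - 0# * (x + y)        ≡⟨ solve 1 (λ t → :0 :- :0 :* t := :0) refl (x + y) ⟩
      0#                       ∎

    C≡0 : C ≡ 0#
    C≡0 = begin
      C
        ≡⟨ solve 4 (λ A B C x → C := (A :* x :+ B) :* x :+ C :- (A :* x :+ B) :* x) refl A B C x ⟩
      quadratic A B C x - (A * x + B) * x  ≡⟨ cong₂ (λ v a → v - (a * x + B) * x) qx A≡0 ⟩
      0# - (0# * x + B) * x                ≡⟨ cong (λ b → 0# - (0# * x + b) * x) B≡0 ⟩
      0# - (0# * x + 0#) * x               ≡⟨ solve 1 (λ x → :0 :- (:0 :* x :+ :0) :* x := :0) refl x ⟩
      0#                                   ∎

module Counting {q : ℕ} (K : FiniteField q) where
  open FiniteField K
  open Inverse card using (to; from; strictlyInverseˡ; strictlyInverseʳ)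
  open ≡-Reasoning

  elements : List F
  elements = map from (allFin q)

  elements-unique : Unique elements
  elements-unique = map⁺ from-injective (allFin⁺ q)
    where
    from-injective : ∀ {k l} → from k ≡ from l → k ≡ l
    from-injective {k} {l} eq =
      trans (sym (strictlyInverseˡ k)) (trans (cong to eq) (strictlyInverseˡ l))

  ∈-elements : ∀ x → x ∈ elements
  ∈-elements x = subst (_∈ elements) (strictlyInverseʳ x) (∈-map⁺ from (∈-allFin (to x)))

  search : ∀ {P : Pred F 0ℓ} → Decidable P → Σ F P ⊎ (∀ x → ¬ P x)
  search P? with Any.any? P? elements
  ... | yes ∃P = inj₁ (Any.satisfied ∃P)
  ... | no ∄P  = inj₂ (λ x px → ∄P (Any.map (λ { refl → px }) (∈-elements x)))

  ∑ : (F → ℕ) → ℕ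
  ∑ f = sum (map f elements)

  ∑-cong : ∀ {f g} → (∀ x → f x ≡ g x) → ∑ f ≡ ∑ g
  ∑-cong f≗g = cong sum (List.map-cong f≗g elements)

  ∑-+ : ∀ f g → ∑ (λ x → f x ℕ.+ g x) ≡ ∑ f ℕ.+ ∑ g
  ∑-+ f g = sum-map-+ f g elements

  ∑-point : ∀ {f u} → (∀ x → x ≢ u → f x ≡ 0) → ∑ f ≡ f u
  ∑-point {u = u} = sum-map-point elements-unique (∈-elements u)

  ∑-1≡q : ∑ (λ _ → 1) ≡ q
  ∑-1≡q = begin
    sum (map (λ _ → 1) elements)  ≡⟨ sum-1 elements ⟩
    length elements               ≡⟨ List.length-map from (allFin q) ⟩
    length (allFin q)             ≡⟨ List.length-tabulate (λ k → k) ⟩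
    q                             ∎
    where
    sum-1 : ∀ (xs : List F) → sum (map (λ _ → 1) xs) ≡ length xs
    sum-1 []       = refl
    sum-1 (x ∷ xs) = cong suc (sum-1 xs)

  ∑-point-mass : ∀ c u → ∑ (λ x → c when (x ≟ u)) ≡ c
  ∑-point-mass c u = trans (∑-point outside) (at-u (u ≟ u))
    where
    outside : ∀ x → x ≢ u → c when (x ≟ u) ≡ 0
    outside x x≢u with x ≟ u
    ... | yes x≡u = ⊥-elim (x≢u x≡u)
    ... | no _    = refl
    at-u : (d : Dec (u ≡ u)) → c when d ≡ c
    at-u (yes _)  = refl
    at-u (no u≢u) = ⊥-elim (u≢u refl)

  ∑-agree-off-point : ∀ {f g} u → (∀ x → x ≢ u → f x ≡ g x) → ∑ f ℕ.+ g u ≡ ∑ g ℕ.+ f u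
  ∑-agree-off-point {f} {g} u f≡g = begin
    ∑ f ℕ.+ g u                                  ≡⟨ cong (∑ f ℕ.+_) (∑-point-mass (g u) u) ⟨
    ∑ f ℕ.+ ∑ (λ x → g u when (x ≟ u))           ≡⟨ ∑-+ f _ ⟨
    ∑ (λ x → f x ℕ.+ g u when (x ≟ u))           ≡⟨ ∑-cong pointwise ⟩
    ∑ (λ x → g x ℕ.+ f u when (x ≟ u))           ≡⟨ ∑-+ g _ ⟩
    ∑ g ℕ.+ ∑ (λ x → f u when (x ≟ u))           ≡⟨ cong (∑ g ℕ.+_) (∑-point-mass (f u) u) ⟩
    ∑ g ℕ.+ f u                                  ∎
    where
    pointwise : ∀ x → f x ℕ.+ g u when (x ≟ u) ≡ g x ℕ.+ f u when (x ≟ u)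
    pointwise x with x ≟ u
    ... | yes refl = ℕ.+-comm (f x) (g x)
    ... | no x≢u   = cong (ℕ._+ 0) (f≡g x x≢u)

  ∑-agree-off-two-points : ∀ {f g} u v → u ≢ v → (∀ x → x ≢ u → x ≢ v → f x ≡ g x) →
                           ∑ f ℕ.+ (g u ℕ.+ g v) ≡ ∑ g ℕ.+ (f u ℕ.+ f v)
  ∑-agree-off-two-points {f} {g} u v u≢v f≡g = begin
    ∑ f ℕ.+ (g u ℕ.+ g v)        ≡⟨ cong (∑ f ℕ.+_) (masses g) ⟨
    ∑ f ℕ.+ ∑ (mass g)           ≡⟨ ∑-+ f (mass g) ⟨
    ∑ (λ x → f x ℕ.+ mass g x)   ≡⟨ ∑-cong pointwise ⟩
    ∑ (λ x → g x ℕ.+ mass f x)   ≡⟨ ∑-+ g (mass f) ⟩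
    ∑ g ℕ.+ ∑ (mass f)           ≡⟨ cong (∑ g ℕ.+_) (masses f) ⟩
    ∑ g ℕ.+ (f u ℕ.+ f v)        ∎
    where
    mass : (F → ℕ) → F → ℕ
    mass h x = h u when (x ≟ u) ℕ.+ h v when (x ≟ v)
    masses : ∀ h → ∑ (mass h) ≡ h u ℕ.+ h v
    masses h = trans (∑-+ _ _) (cong₂ ℕ._+_ (∑-point-mass (h u) u) (∑-point-mass (h v) v))
    pointwise : ∀ x → f x ℕ.+ mass g x ≡ g x ℕ.+ mass f x
    pointwise x with x ≟ u | x ≟ v
    ... | yes refl | yes refl = ⊥-elim (u≢v refl)
    ... | yes refl | no _     rewrite ℕ.+-identityʳ (f x) | ℕ.+-identityʳ (g x) = ℕ.+-comm (f x) (g x)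
    ... | no _     | yes refl = ℕ.+-comm (f x) (g x)
    ... | no x≢u   | no x≢v   = cong (ℕ._+ 0) (f≡g x x≢u x≢v)

  count : ∀ {P : Pred F 0ℓ} → Decidable P → ℕ
  count P? = ∑ (λ x → 𝟙 (P? x))

  _∖_ : ∀ {P : Pred F 0ℓ} → Decidable P → (u : F) → Decidable (λ x → P x × x ≢ u)
  (P? ∖ u) x = P? x ×-dec ¬? (x ≟ u)

  count-empty : ∀ {P : Pred F 0ℓ} (P? : Decidable P) → (∀ x → ¬ P x) → count P? ≡ 0
  count-empty P? ∄P = trans (∑-point (λ x _ → 𝟙-no (∄P x) (P? x))) (𝟙-no (∄P 0#) (P? 0#))

  count-¬+count≡q : ∀ {P : Pred F 0ℓ} (P? : Decidable P) → count (λ x → ¬? (P? x)) ℕ.+ count P? ≡ q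
  count-¬+count≡q P? = begin
    count (λ x → ¬? (P? x)) ℕ.+ count P?  ≡⟨ ∑-+ _ _ ⟨
    ∑ (λ x → 𝟙 (¬? (P? x)) ℕ.+ 𝟙 (P? x))  ≡⟨ ∑-cong (λ x → 𝟙-¬?+𝟙 (P? x)) ⟩
    ∑ (λ _ → 1)                            ≡⟨ ∑-1≡q ⟩
    q                                      ∎

  count-remove : ∀ {P : Pred F 0ℓ} (P? : Decidable P) {u} → P u → count P? ≡ suc (count (P? ∖ u))
  count-remove P? {u} Pu = begin
    count P?                                              ≡⟨ ∑-cong split ⟩
    ∑ (λ x → 1 when (x ≟ u) ℕ.+ 𝟙 ((P? ∖ u) x))           ≡⟨ ∑-+ _ _ ⟩
    ∑ (λ x → 1 when (x ≟ u)) ℕ.+ count (P? ∖ u)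
      ≡⟨ cong (ℕ._+ count (P? ∖ u)) (∑-point-mass 1 u) ⟩
    suc (count (P? ∖ u))                                  ∎
    where
    split : ∀ x → 𝟙 (P? x) ≡ 1 when (x ≟ u) ℕ.+ 𝟙 ((P? ∖ u) x)
    split x with x ≟ u
    ... | yes refl = trans (𝟙-yes Pu (P? x)) (cong suc (sym (𝟙-no (λ (_ , x≢x) → x≢x refl) (P? x ×-dec no _))))
    ... | no x≢u   = 𝟙-cong (_, x≢u) proj₁ (P? x) (P? x ×-dec yes x≢u)

  count≤2 : ∀ {P : Pred F 0ℓ} (P? : Decidable P) →
            (∀ {x y z} → P x → P y → P z → x ≢ y → x ≢ z → y ≢ z → ⊥) → count P? ≤ 2
  count≤2 P? no-three with search P?
  ... | inj₂ ∄P = subst (_≤ 2) (sym (count-empty P? ∄P)) z≤n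
  ... | inj₁ (x , Px) with search (P? ∖ x)
  ...   | inj₂ ∄P₁ =
            subst (_≤ 2) (sym (trans (count-remove P? Px) (cong suc (count-empty (P? ∖ x) ∄P₁)))) (s≤s z≤n)
  ...   | inj₁ (y , Py₁) with search ((P? ∖ x) ∖ y)
  ...     | inj₂ ∄P₂ = ℕ.≤-reflexive (trans (count-remove P? Px)
                          (cong suc (trans (count-remove (P? ∖ x) Py₁) (cong suc (count-empty ((P? ∖ x) ∖ y) ∄P₂)))))
  ...     | inj₁ (z , (Pz , z≢x) , z≢y) =
              ⊥-elim (no-three Px (proj₁ Py₁) Pz (proj₂ Py₁ ∘ sym) (z≢x ∘ sym) (z≢y ∘ sym))

  count≡2 : ∀ {P : Pred F 0ℓ} (P? : Decidable P) {u v} → u ≢ v →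
            (∀ x → P x ⇔ (x ≡ u ⊎ x ≡ v)) → count P? ≡ 2
  count≡2 {P} P? {u} {v} u≢v P⇔ = begin
    count P?                    ≡⟨ count-remove P? (Equivalence.from (P⇔ u) (inj₁ refl)) ⟩
    suc (count (P? ∖ u))
      ≡⟨ cong suc (count-remove (P? ∖ u) (Equivalence.from (P⇔ v) (inj₂ refl) , u≢v ∘ sym)) ⟩
    2 ℕ.+ count ((P? ∖ u) ∖ v)  ≡⟨ cong (2 ℕ.+_) (count-empty ((P? ∖ u) ∖ v) only-u-v) ⟩
    2                           ∎
    where
    only-u-v : ∀ x → ¬ ((P x × x ≢ u) × x ≢ v)
    only-u-v x ((Px , x≢u) , x≢v) = [ x≢u , x≢v ]′ (Equivalence.to (P⇔ x) Px)

  record FreeOrder3 (τ : F → F) (P : Pred F 0ℓ) : Set where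
    field
      closed        : ∀ {x} → P x → P (τ x)
      cubed         : ∀ {x} → P x → τ (τ (τ x)) ≡ x
      fixpoint-free : ∀ {x} → P x → τ x ≢ x

    injective : ∀ {x y} → P x → P y → τ x ≡ τ y → x ≡ y
    injective {x} {y} Px Py τx≡τy = begin
      x              ≡⟨ cubed Px ⟨
      τ (τ (τ x))    ≡⟨ cong (τ ∘ τ) τx≡τy ⟩
      τ (τ (τ y))    ≡⟨ cubed Py ⟩
      y              ∎

  3∣count : ∀ {τ} {P : Pred F 0ℓ} (P? : Decidable P) → FreeOrder3 τ P → 3 ∣ count P?
  3∣count P? free = go q P? free (subst (count P? ≤_) (count-¬+count≡q P?) (ℕ.m≤n+m _ _))
    where
    go : ∀ n {τ} {P : Pred F 0ℓ} (P? : Decidable P) → FreeOrder3 τ P → count P? ≤ n → 3 ∣ count P?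
    go zero P? free count≤0 = subst (3 ∣_) (sym (ℕ.n≤0⇒n≡0 count≤0)) (divides 0 refl)
    go (suc n) {τ} P? free count≤1+n with search P?
    ... | inj₂ ∄P = subst (3 ∣_) (sym (count-empty P? ∄P)) (divides 0 refl)
    ... | inj₁ (x , Px) = subst (3 ∣_) (sym count≡3+) (∣m∣n⇒∣m+n (∣-refl {3}) (go n P₃? free₃ count₃≤n))
      where
      open FreeOrder3 free
      y = τ x
      z = τ y
      Py = closed Px
      Pz = closed Py
      y≢x : y ≢ x
      y≢x = fixpoint-free Px
      z≢y : z ≢ y
      z≢y = fixpoint-free Py
      z≢x : z ≢ x
      z≢x z≡x = fixpoint-free Px (sym (trans (sym (cubed Px)) (cong τ z≡x)))
      P₃? = ((P? ∖ x) ∖ y) ∖ z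
      count≡3+ : count P? ≡ 3 ℕ.+ count P₃?
      count≡3+ = trans (count-remove P? Px) (cong suc (trans (count-remove (P? ∖ x) (Py , y≢x))
                   (cong suc (count-remove ((P? ∖ x) ∖ y) ((Pz , z≢x) , z≢y)))))
      count₃≤n : count P₃? ≤ n
      count₃≤n = ℕ.≤-trans (ℕ.m≤n+m _ 2) (ℕ.s≤s⁻¹ (subst (_≤ suc n) count≡3+ count≤1+n))
      free₃ : FreeOrder3 τ _
      free₃ = record
        { closed = λ { {w} (((Pw , w≢x) , w≢y) , w≢z) →
            ((closed Pw , (λ τw≡x → w≢z (trans (sym (cubed Pw)) (cong (τ ∘ τ) τw≡x))))
                        , (λ τw≡y → w≢x (injective Pw Px τw≡y)))
                        , (λ τw≡z → w≢y (injective Pw Py τw≡z)) }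
        ; cubed = λ P₃w → cubed (proj₁ (proj₁ (proj₁ P₃w)))
        ; fixpoint-free = λ P₃w → fixpoint-free (proj₁ (proj₁ (proj₁ P₃w)))
        }

module CubeRoots {q : ℕ} (K : FiniteField q) (q%3≡1 : q % 3 ≡ 1) where
  open FiniteField K
  open FieldProperties K
  open Counting K
  open ≡-Reasoning

  everything? : Decidable {A = F} (λ _ → ⊤)
  everything? _ = yes tt

  three≢0 : 1# + 1# + 1# ≢ 0#
  three≢0 3≡0 = ℕ.0≢1+n (begin
    0                        ≡⟨ n∣m⇒m%n≡0 q 3 (subst (3 ∣_) ∑-1≡q (3∣count everything? translation)) ⟨
    q % 3                    ≡⟨ q%3≡1 ⟩
    1                        ∎)
    where
    translation : FreeOrder3 (_+ 1#) (λ _ → ⊤)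
    translation = record
      { closed        = λ _ → tt
      ; cubed         = λ {x} _ → begin
          x + 1# + 1# + 1#       ≡⟨ solve 1 (λ x → x :+ :1 :+ :1 :+ :1
                                      := x :+ (:1 :+ :1 :+ :1)) refl x ⟩
          x + (1# + 1# + 1#)     ≡⟨ cong (x +_) 3≡0 ⟩
          x + 0#                 ≡⟨ +-identityʳ x ⟩
          x                      ∎
      ; fixpoint-free = λ {x} _ x+1≡x → 1≢0 (begin
          1#                     ≡⟨ solve 1 (λ x → :1 := x :+ :1 :- x) refl x ⟩
          x + 1# - x             ≡⟨ x≡y⇒x-y≡0 x+1≡x ⟩
          0#                     ∎)
      }

  off-0-1? : Decidable (λ x → (⊤ × x ≢ 0#) × x ≢ 1#)
  off-0-1? = (everything? ∖ 0#) ∖ 1#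

  q≡2+count-off-0-1 : q ≡ 2 ℕ.+ count off-0-1?
  q≡2+count-off-0-1 = begin
    q                                ≡⟨ ∑-1≡q ⟨
    count everything?                ≡⟨ count-remove everything? tt ⟩
    suc (count (everything? ∖ 0#))   ≡⟨ cong suc (count-remove (everything? ∖ 0#) (tt , 1≢0)) ⟩
    2 ℕ.+ count off-0-1?             ∎

  τ : F → F
  τ x = (1# - x) ⁻¹

  1-x≢0 : ∀ {x} → x ≢ 1# → 1# - x ≢ 0#
  1-x≢0 x≢1 = x≢1 ∘ sym ∘ x-y≡0⇒x≡y _ _

  τx*[1-x]≡1 : ∀ {x} → x ≢ 1# → τ x * (1# - x) ≡ 1#
  τx*[1-x]≡1 x≢1 = ⁻¹-inverseˡ (1-x≢0 x≢1)

  τx≢0 : ∀ {x} → x ≢ 1# → τ x ≢ 0#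
  τx≢0 x≢1 = ⁻¹-≢0 (1-x≢0 x≢1)

  τx≢1 : ∀ {x} → x ≢ 0# → x ≢ 1# → τ x ≢ 1#
  τx≢1 {x} x≢0 x≢1 τx≡1 = x≢0 (begin
    x                  ≡⟨ solve 1 (λ x → x := :1 :- (:1 :- x)) refl x ⟩
    1# - (1# - x)      ≡⟨ cong (λ t → 1# - t) 1-x≡1 ⟩
    1# - 1#            ≡⟨ -‿inverseʳ 1# ⟩
    0#                 ∎)
    where
    1-x≡1 : 1# - x ≡ 1#
    1-x≡1 = trans (sym (*-identityˡ _)) (subst (λ t → t * (1# - x) ≡ 1#) τx≡1 (τx*[1-x]≡1 x≢1))

  τ³≡id : ∀ {x} → x ≢ 0# → x ≢ 1# → τ (τ (τ x)) ≡ x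
  τ³≡id {x} x≢0 x≢1 = ⁻¹-unique (1-x≢0 t′≢1) (trans (*-comm _ _) x[1-t′]≡1)
    where
    t = τ x
    t′ = τ t
    t≢1 : t ≢ 1#
    t≢1 = τx≢1 x≢0 x≢1
    t′≢1 : t′ ≢ 1#
    t′≢1 = τx≢1 (τx≢0 x≢1) t≢1
    x[1-t′]≡1 : x * (1# - t′) ≡ 1#
    x[1-t′]≡1 = x-y≡0⇒x≡y _ _ (*-cancelˡ-≡0 (τx≢0 x≢1) (begin
      t * (x * (1# - t′) - 1#)
        ≡⟨ solve 3 (λ x t t′ → t :* (x :* (:1 :- t′) :- :1)
             := (t′ :- :1) :* (t :* (:1 :- x) :- :1) :+ (t′ :* (:1 :- t) :- :1)) refl x t t′ ⟩
      (t′ - 1#) * (t * (1# - x) - 1#) + (t′ * (1# - t) - 1#)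
        ≡⟨ cong₂ (λ u v → (t′ - 1#) * (u - 1#) + (v - 1#)) (τx*[1-x]≡1 x≢1) (τx*[1-x]≡1 t≢1) ⟩
      (t′ - 1#) * (1# - 1#) + (1# - 1#)
        ≡⟨ solve 1 (λ t′ → (t′ :- :1) :* (:1 :- :1) :+ (:1 :- :1) := :0) refl t′ ⟩
      0# ∎))

  τx≡x⇒x²-x+1≡0 : ∀ {x} → x ≢ 1# → τ x ≡ x → x * x - x + 1# ≡ 0#
  τx≡x⇒x²-x+1≡0 {x} x≢1 τx≡x = begin
    x * x - x + 1#       ≡⟨ solve 1 (λ x → x :* x :- x :+ :1 := :1 :- x :* (:1 :- x)) refl x ⟩
    1# - x * (1# - x)    ≡⟨ cong (λ t → 1# - t * (1# - x)) τx≡x ⟨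
    1# - τ x * (1# - x)  ≡⟨ cong (λ t → 1# - t) (τx*[1-x]≡1 x≢1) ⟩
    1# - 1#              ≡⟨ -‿inverseʳ 1# ⟩
    0#                   ∎

  root-of-x²-x+1 : Σ F λ x → x * x - x + 1# ≡ 0#
  root-of-x²-x+1 with search (λ x → (x * x - x + 1#) ≟ 0#)
  ... | inj₁ root    = root
  ... | inj₂ no-root = ⊥-elim (2≢1 (trans (sym q%3≡2) q%3≡1))
    where
    free : FreeOrder3 τ _
    free = record
      { closed        = λ { ((_ , x≢0) , x≢1) → (tt , τx≢0 x≢1) , τx≢1 x≢0 x≢1 }
      ; cubed         = λ { ((_ , x≢0) , x≢1) → τ³≡id x≢0 x≢1 }
      ; fixpoint-free = λ { {x} (_ , x≢1) → no-root x ∘ τx≡x⇒x²-x+1≡0 x≢1 }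
      }
    q%3≡2 : q % 3 ≡ 2
    q%3≡2 with 3∣count off-0-1? free
    ... | divides k count≡k*3 = begin
      q % 3                  ≡⟨ cong (_% 3) (trans q≡2+count-off-0-1 (cong (2 ℕ.+_) count≡k*3)) ⟩
      (2 ℕ.+ k ℕ.* 3) % 3    ≡⟨ [m+kn]%n≡m%n 2 k 3 ⟩
      2                      ∎
    2≢1 : 2 ≢ 1
    2≢1 ()

  cube-root-of-unity : Σ F λ ω → ω * ω + ω + 1# ≡ 0# × ω ≢ 1#
  cube-root-of-unity = - x , ω²+ω+1≡0 , ω≢1
    where
    x = proj₁ root-of-x²-x+1
    ω²+ω+1≡0 : - x * - x + - x + 1# ≡ 0#
    ω²+ω+1≡0 = trans (solve 1 (λ x → :- x :* :- x :+ :- x :+ :1 := x :* x :- x :+ :1) refl x)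
                     (proj₂ root-of-x²-x+1)
    ω≢1 : - x ≢ 1#
    ω≢1 ω≡1 = three≢0 (trans (cong (λ t → t + 1# + 1#) (sym (*-identityˡ 1#)))
                             (subst (λ w → w * w + w + 1# ≡ 0#) ω≡1 ω²+ω+1≡0))

module ProjectiveLine {q : ℕ} (K : FiniteField q) where
  open FiniteField K
  open FieldProperties K
  open Counting K
  open Inverse card using (from)
  open ≡-Reasoning

  differ : P1 → P1 → ℕ
  differ u v = 𝟙 (¬? (u ≟P v))

  differ-≡ : ∀ {u v} → u ≡ v → differ u v ≡ 0
  differ-≡ {u} {v} u≡v = 𝟙-no (λ u≢v → u≢v u≡v) (¬? (u ≟P v))

  differ-≢ : ∀ {u v} → u ≢ v → differ u v ≡ 1
  differ-≢ {u} {v} u≢v = 𝟙-yes u≢v (¬? (u ≟P v))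

  differ≡0⇒≡ : ∀ {u v} → differ u v ≡ 0 → u ≡ v
  differ≡0⇒≡ {u} {v} with u ≟P v
  ... | yes u≡v = λ _ → u≡v
  ... | no _    = λ ()

  differ≤1 : ∀ u v → differ u v ≤ 1
  differ≤1 u v = 𝟙≤1 (¬? (u ≟P v))

  disagree : (P1 → P1) → (P1 → P1) → F → ℕ
  disagree φ ψ x = differ (φ (just x)) (ψ (just x))

  agree? : (φ ψ : P1 → P1) → Decidable (λ x → φ (just x) ≡ ψ (just x))
  agree? φ ψ x = φ (just x) ≟P ψ (just x)

  hd≡differ-∞+∑disagree : ∀ φ ψ → hd φ ψ ≡ differ (φ ∞) (ψ ∞) ℕ.+ ∑ (disagree φ ψ)
  hd≡differ-∞+∑disagree φ ψ = begin
    hd φ ψ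
      ≡⟨ length-filter≡sum-𝟙 (λ x → ¬? (φ x ≟P ψ x)) points ⟩
    differ (φ ∞) (ψ ∞) ℕ.+ sum (map (λ x → differ (φ x) (ψ x)) (map (just ∘ from) (allFin q)))
      ≡⟨ cong (λ xs → differ (φ ∞) (ψ ∞) ℕ.+ sum xs)
              (trans (sym (List.map-∘ (allFin q))) (List.map-∘ (allFin q))) ⟩
    differ (φ ∞) (ψ ∞) ℕ.+ ∑ (disagree φ ψ) ∎

  hd-tri≡∑disagree : ∀ φ ψ → hd (tri φ) (tri ψ) ≡ ∑ (disagree (tri φ) (tri ψ))
  hd-tri≡∑disagree φ ψ = hd≡differ-∞+∑disagree (tri φ) (tri ψ)

  ∑disagree+count-agree≡q : ∀ φ ψ → ∑ (disagree φ ψ) ℕ.+ count (agree? φ ψ) ≡ q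
  ∑disagree+count-agree≡q φ ψ = count-¬+count≡q (agree? φ ψ)

  frac-pole : ∀ a r i → frac a r i (just i) ≡ ∞
  frac-pole a r i with i ≟ i
  ... | yes _   = refl
  ... | no i≢i  = ⊥-elim (i≢i refl)

  frac-regular : ∀ a r i {x} → x ≢ i → frac a r i (just x) ≡ just (a + r * (x - i) ⁻¹)
  frac-regular a r i {x} x≢i with x ≟ i
  ... | yes x≡i = ⊥-elim (x≢i x≡i)
  ... | no _    = refl

  tri-frac-pole : ∀ a r i → tri (frac a r i) (just i) ≡ just a
  tri-frac-pole a r i with frac a r i (just i) ≟P ∞
  ... | yes _     = refl
  ... | no ≢∞     = ⊥-elim (≢∞ (frac-pole a r i))

  tri-frac-regular : ∀ a r i {x} → x ≢ i → tri (frac a r i) (just x) ≡ frac a r i (just x)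
  tri-frac-regular a r i {x} x≢i with frac a r i (just x) ≟P ∞
  ... | yes ≡∞ = ⊥-elim (just≢nothing (trans (sym (frac-regular a r i x≢i)) ≡∞))
    where
    just≢nothing : ∀ {y : F} → just y ≢ nothing
    just≢nothing ()
  ... | no _   = refl

  frac∈PGL : ∀ a r i → r ≢ 0# → InPGL (frac a r i)
  frac∈PGL a r i r≢0 = a , r - a * i , 1# , - i , det≢0 , pointwise
    where
    det≢0 : a * - i ≢ (r - a * i) * 1#
    det≢0 eq = r≢0 (begin
      r                               ≡⟨ solve 3 (λ a r i → r := (r :- a :* i) :* :1 :- a :* :- i) refl a r i ⟩
      (r - a * i) * 1# - a * - i      ≡⟨ x≡y⇒x-y≡0 (sym eq) ⟩
      0#                              ∎)
    pointwise : ∀ x → frac a r i x ≡ mob a (r - a * i) 1# (- i) x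
    pointwise nothing with 1# ≟ 0#
    ... | yes 1≡0 = ⊥-elim (1≢0 1≡0)
    ... | no _    = cong just (sym (trans (cong (a *_) 1⁻¹≡1) (*-identityʳ a)))
    pointwise (just x) with x ≟ i | (1# * x + - i) ≟ 0#
    ... | yes refl | yes _     = refl
    ... | yes refl | no d≢0    = ⊥-elim (d≢0 (solve 1 (λ x → :1 :* x :- x := :0) refl x))
    ... | no x≢i   | yes d≡0   =
          ⊥-elim (x≢y⇒x-y≢0 x≢i (trans (cong (_- i) (sym (*-identityˡ x))) d≡0))
    ... | no x≢i   | no _      = cong just (begin
      a + r * (x - i) ⁻¹
        ≡⟨ cong (_+ r * (x - i) ⁻¹) (*-identityʳ a) ⟨
      a * 1# + r * (x - i) ⁻¹
        ≡⟨ cong (λ t → a * t + r * (x - i) ⁻¹) (⁻¹-inverseʳ (x≢y⇒x-y≢0 x≢i)) ⟨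
      a * ((x - i) * (x - i) ⁻¹) + r * (x - i) ⁻¹
        ≡⟨ solve 5 (λ a r i x U → a :* ((x :- i) :* U) :+ r :* U := (a :* x :+ (r :- a :* i)) :* U)
             refl a r i x ((x - i) ⁻¹) ⟩
      (a * x + (r - a * i)) * (x - i) ⁻¹
        ≡⟨ cong (λ t → (a * x + (r - a * i)) * (t - i) ⁻¹) (*-identityˡ x) ⟨
      (a * x + (r - a * i)) * (1# * x - i) ⁻¹ ∎)

module TwoFractions {q : ℕ} (K : FiniteField q) (a b i j r s : FiniteField.F K) where
  open FiniteField K
  open FieldProperties K
  open ProjectiveLine K
  open ≡-Reasoning

  π σ : P1 → P1
  π = frac a r i
  σ = frac b s j

  -- π x ≡ σ x cleared of the denominators (x - i)(x - j)
  agreement-polynomial : F → F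
  agreement-polynomial x = (a - b) * ((x - i) * (x - j)) + (r * (x - j) - s * (x - i))

  agree⇔root-off-poles : ∀ {x} → x ≢ i → x ≢ j → π (just x) ≡ σ (just x) ⇔ agreement-polynomial x ≡ 0#
  agree⇔root-off-poles {x} x≢i x≢j = mk⇔
    (λ eq → Equivalence.to fractions⇔
              (just-injective (trans (sym (frac-regular a r i x≢i)) (trans eq (frac-regular b s j x≢j)))))
    (λ eq → trans (frac-regular a r i x≢i)
              (trans (cong just (Equivalence.from fractions⇔ eq)) (sym (frac-regular b s j x≢j))))
    where
    fractions⇔ = a+r/u≡b+s/w⇔ (x≢y⇒x-y≢0 x≢i) (x≢y⇒x-y≢0 x≢j)

  agreement-polynomial≡quadratic : ∀ x → agreement-polynomial x ≡
    quadratic (a - b) ((a - b) * (i - j) + (r - s)) (r * (i - j)) (x - i)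
  agreement-polynomial≡quadratic x = solve 7 (λ a b r s i j x →
      (a :- b) :* ((x :- i) :* (x :- j)) :+ (r :* (x :- j) :- s :* (x :- i))
      := ((a :- b) :* (x :- i) :+ ((a :- b) :* (i :- j) :+ (r :- s))) :* (x :- i) :+ r :* (i :- j))
    refl a b r s i j x

  three-roots : ∀ {x y z} → x ≢ y → x ≢ z → y ≢ z →
    agreement-polynomial x ≡ 0# → agreement-polynomial y ≡ 0# → agreement-polynomial z ≡ 0# →
    a - b ≡ 0# × (a - b) * (i - j) + (r - s) ≡ 0# × r * (i - j) ≡ 0#
  three-roots x≢y x≢z y≢z Qx Qy Qz = three-roots⇒coefficients≡0
    (shift x≢y) (shift x≢z) (shift y≢z) (on-quadratic Qx) (on-quadratic Qy) (on-quadratic Qz)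
    where
    shift : ∀ {u v} → u ≢ v → u - i ≢ v - i
    shift u≢v = u≢v ∘ +-cancelʳ (- i) _ _
    on-quadratic = λ {u} Qu → trans (sym (agreement-polynomial≡quadratic u)) Qu

module EqualPoles {q : ℕ} (K : FiniteField q) (a b i r s : FiniteField.F K) where
  open FiniteField K
  open FieldProperties K
  open Counting K
  open ProjectiveLine K
  open TwoFractions K a b i i r s
  open ≡-Reasoning

  tri-agree⇒root : ∀ {x} → tri π (just x) ≡ tri σ (just x) → agreement-polynomial x ≡ 0#
  tri-agree⇒root {x} eq = by-cases (x ≟ i)
    where
    by-cases : Dec (x ≡ i) → agreement-polynomial x ≡ 0#
    -- with j = i every term of the agreement polynomial has the factor x - i
    by-cases (yes x≡i) = subst (λ t → agreement-polynomial t ≡ 0#) (sym x≡i) (solve 5 (λ a b r s i →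
      (a :- b) :* ((i :- i) :* (i :- i)) :+ (r :* (i :- i) :- s :* (i :- i)) := :0) refl a b r s i)
    by-cases (no x≢i)  = Equivalence.to (agree⇔root-off-poles x≢i x≢i)
      (trans (sym (tri-frac-regular a r i x≢i)) (trans eq (tri-frac-regular b s i x≢i)))

  tri-agreements≤2 : ¬ (∀ x → π x ≡ σ x) → count (agree? (tri π) (tri σ)) ≤ 2
  tri-agreements≤2 π≢σ = count≤2 (agree? (tri π) (tri σ)) λ Tx Ty Tz x≢y x≢z y≢z →
    let (a-b≡0 , slope≡0 , _) =
          three-roots x≢y x≢z y≢z (tri-agree⇒root Tx) (tri-agree⇒root Ty) (tri-agree⇒root Tz)
        a≡b = x-y≡0⇒x≡y _ _ a-b≡0
        r≡s = x-y≡0⇒x≡y _ _ (trans (sym (linear-coefficient a-b≡0)) slope≡0)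
    in π≢σ (λ t → cong₂ (λ a′ r′ → frac a′ r′ i t) a≡b r≡s)
    where
    linear-coefficient : a - b ≡ 0# → (a - b) * (i - i) + (r - s) ≡ r - s
    linear-coefficient a-b≡0 = trans (cong (λ d → d * (i - i) + (r - s)) a-b≡0)
      (trans (cong (_+ (r - s)) (zeroˡ _)) (+-identityˡ _))

  hd-tri≡hd : hd (tri π) (tri σ) ≡ hd π σ
  hd-tri≡hd = begin
    hd (tri π) (tri σ)
      ≡⟨ hd-tri≡∑disagree π σ ⟩
    ∑ (disagree (tri π) (tri σ))
      ≡⟨ ℕ.+-identityʳ _ ⟨
    ∑ (disagree (tri π) (tri σ)) ℕ.+ 0
      ≡⟨ cong (∑ (disagree (tri π) (tri σ)) ℕ.+_) (sym (cong₂ differ (frac-pole a r i) (frac-pole b s i))) ⟩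
    ∑ (disagree (tri π) (tri σ)) ℕ.+ disagree π σ i
      ≡⟨ ∑-agree-off-point i (λ x x≢i →
           cong₂ differ (tri-frac-regular a r i x≢i) (tri-frac-regular b s i x≢i)) ⟩
    ∑ (disagree π σ) ℕ.+ disagree (tri π) (tri σ) i
      ≡⟨ cong (∑ (disagree π σ) ℕ.+_) (cong₂ differ (tri-frac-pole a r i) (tri-frac-pole b s i)) ⟩
    ∑ (disagree π σ) ℕ.+ differ (just a) (just b)
      ≡⟨ ℕ.+-comm (∑ (disagree π σ)) _ ⟩
    differ (just a) (just b) ℕ.+ ∑ (disagree π σ)
      ≡⟨ hd≡differ-∞+∑disagree π σ ⟨
    hd π σ ∎

  ¬hd-drop : hd (tri π) (tri σ) ℕ.+ 3 ≢ hd π σ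
  ¬hd-drop eq = ℕ.m+1+n≰m (hd π σ) (ℕ.≤-reflexive (trans (cong (ℕ._+ 3) (sym hd-tri≡hd)) eq))

  ¬Edge : ¬ Edge π σ
  ¬Edge (_ , _ , π≢σ , hd-tri+4≡q) = 4≰2 (ℕ.≤-trans (ℕ.≤-reflexive 4≡count) (tri-agreements≤2 π≢σ))
    where
    4≰2 : ¬ 4 ≤ 2
    4≰2 (s≤s (s≤s ()))
    4≡count : 4 ≡ count (agree? (tri π) (tri σ))
    4≡count = ℕ.+-cancelˡ-≡ (∑ (disagree (tri π) (tri σ))) _ _
      (trans (trans (cong (ℕ._+ 4) (sym (hd-tri≡∑disagree π σ))) hd-tri+4≡q)
             (sym (∑disagree+count-agree≡q (tri π) (tri σ))))

module DistinctPoles {q : ℕ} (K : FiniteField q) (a b i j r s : FiniteField.F K)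
  (r≢0 : r ≢ FiniteField.0# K) (s≢0 : s ≢ FiniteField.0# K) (i≢j : i ≢ j) where
  open FiniteField K
  open FieldProperties K
  open Counting K
  open ProjectiveLine K
  open TwoFractions K a b i j r s
  open ≡-Reasoning

  i-j≢0 : i - j ≢ 0#
  i-j≢0 = x≢y⇒x-y≢0 i≢j

  j≢i : j ≢ i
  j≢i = i≢j ∘ sym

  σ-at-i : σ (just i) ≡ just (b + s * (i - j) ⁻¹)
  σ-at-i = frac-regular b s j i≢j

  π-at-j : π (just j) ≡ just (a + r * (j - i) ⁻¹)
  π-at-j = frac-regular a r i j≢i

  agree⇔root : ∀ x → π (just x) ≡ σ (just x) ⇔ agreement-polynomial x ≡ 0#
  agree⇔root x = by-cases (x ≟ i) (x ≟ j)
    where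
    at-i : agreement-polynomial i ≡ r * (i - j)
    at-i = solve 6 (λ a b r s i j → (a :- b) :* ((i :- i) :* (i :- j)) :+ (r :* (i :- j) :- s :* (i :- i))
                                    := r :* (i :- j)) refl a b r s i j
    at-j : agreement-polynomial j ≡ s * (i - j)
    at-j = solve 6 (λ a b r s i j → (a :- b) :* ((j :- i) :* (j :- j)) :+ (r :* (j :- j) :- s :* (j :- i))
                                    := s :* (i :- j)) refl a b r s i j
    by-cases : Dec (x ≡ i) → Dec (x ≡ j) → π (just x) ≡ σ (just x) ⇔ agreement-polynomial x ≡ 0#
    by-cases (yes refl) _ = mk⇔
      (λ eq → ⊥-elim (∞≢just (trans (sym (frac-pole a r i)) (trans eq σ-at-i))))
      (λ Qi≡0 → ⊥-elim (*-≢0 r≢0 i-j≢0 (trans (sym at-i) Qi≡0)))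
      where
      ∞≢just : ∀ {y : F} → ∞ ≢ just y
      ∞≢just ()
    by-cases (no _) (yes refl) = mk⇔
      (λ eq → ⊥-elim (just≢∞ (trans (sym π-at-j) (trans eq (frac-pole b s j)))))
      (λ Qj≡0 → ⊥-elim (*-≢0 s≢0 i-j≢0 (trans (sym at-j) Qj≡0)))
      where
      just≢∞ : ∀ {y : F} → just y ≢ ∞
      just≢∞ ()
    by-cases (no x≢i) (no x≢j) = agree⇔root-off-poles x≢i x≢j

  agreements≤2 : count (agree? π σ) ≤ 2
  agreements≤2 = count≤2 (agree? π σ) λ {x} {y} {z} πx≡σx πy≡σy πz≡σz x≢y x≢z y≢z →
    *-≢0 r≢0 i-j≢0 (proj₂ (proj₂ (three-roots x≢y x≢z y≢z (root πx≡σx) (root πy≡σy) (root πz≡σz))))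
    where
    root : ∀ {x} → π (just x) ≡ σ (just x) → agreement-polynomial x ≡ 0#
    root {x} = Equivalence.to (agree⇔root x)

  -- the contribution of ∞ to hd(π, σ) and those of i and j to hd(π△, σ△)
  α β γ : ℕ
  α = differ (just a) (just b)
  β = differ (just a) (σ (just i))
  γ = differ (π (just j)) (just b)

  ∑disagree+β+γ≡∑disagree-tri+2 : ∑ (disagree π σ) ℕ.+ (β ℕ.+ γ) ≡ ∑ (disagree (tri π) (tri σ)) ℕ.+ 2
  ∑disagree+β+γ≡∑disagree-tri+2 = begin
    ∑ (disagree π σ) ℕ.+ (β ℕ.+ γ)
      ≡⟨ cong (∑ (disagree π σ) ℕ.+_) (cong₂ ℕ._+_
           (cong₂ differ (tri-frac-pole a r i) (tri-frac-regular b s j i≢j))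
           (cong₂ differ (tri-frac-regular a r i j≢i) (tri-frac-pole b s j))) ⟨
    ∑ (disagree π σ) ℕ.+ (disagree (tri π) (tri σ) i ℕ.+ disagree (tri π) (tri σ) j)
      ≡⟨ ∑-agree-off-two-points i j i≢j (λ x x≢i x≢j →
           sym (cong₂ differ (tri-frac-regular a r i x≢i) (tri-frac-regular b s j x≢j))) ⟩
    ∑ (disagree (tri π) (tri σ)) ℕ.+ (disagree π σ i ℕ.+ disagree π σ j)
      ≡⟨ cong (∑ (disagree (tri π) (tri σ)) ℕ.+_) (cong₂ ℕ._+_
           (cong₂ differ (frac-pole a r i) σ-at-i)
           (cong₂ differ π-at-j (frac-pole b s j))) ⟩
    ∑ (disagree (tri π) (tri σ)) ℕ.+ 2 ∎

  hd-drop⇔ : hd (tri π) (tri σ) ℕ.+ 3 ≡ hd π σ ⇔ β ℕ.+ γ ℕ.+ 1 ≡ α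
  hd-drop⇔ = ⇔-trans (mk⇔ (λ eq → trans (cong (ℕ._+ 3) (sym (hd-tri≡∑disagree π σ))) (trans eq hd≡))
                          (λ eq → trans (cong (ℕ._+ 3) (hd-tri≡∑disagree π σ)) (trans eq (sym hd≡))))
                     (+-rebalance 1 α ∑disagree+β+γ≡∑disagree-tri+2)
    where
    hd≡ : hd π σ ≡ ∑ (disagree π σ) ℕ.+ α
    hd≡ = trans (hd≡differ-∞+∑disagree π σ) (ℕ.+-comm α _)

  Edge-count⇔ : hd (tri π) (tri σ) ℕ.+ 4 ≡ q ⇔ β ℕ.+ γ ℕ.+ 2 ≡ count (agree? π σ)
  Edge-count⇔ = ⇔-trans (mk⇔ (λ eq → trans (cong (ℕ._+ 4) (sym (hd-tri≡∑disagree π σ))) (trans eq (sym q≡)))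
                             (λ eq → trans (cong (ℕ._+ 4) (hd-tri≡∑disagree π σ)) (trans eq q≡)))
                        (+-rebalance 2 (count (agree? π σ)) ∑disagree+β+γ≡∑disagree-tri+2)
    where
    q≡ : ∑ (disagree π σ) ℕ.+ count (agree? π σ) ≡ q
    q≡ = ∑disagree+count-agree≡q π σ

  β≡0⇒s≡[a-b][i-j] : β ≡ 0 → s ≡ (a - b) * (i - j)
  β≡0⇒s≡[a-b][i-j] β≡0 = x≡y+z/w⇒z≡[x-y]w i-j≢0 (just-injective (trans (differ≡0⇒≡ β≡0) σ-at-i))

  γ≡0⇒r≡[a-b][i-j] : γ ≡ 0 → r ≡ (a - b) * (i - j)
  γ≡0⇒r≡[a-b][i-j] γ≡0 = begin
    r
      ≡⟨ x≡y+z/w⇒z≡[x-y]w (x≢y⇒x-y≢0 j≢i) (sym (just-injective (trans (sym π-at-j) (differ≡0⇒≡ γ≡0)))) ⟩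
    (b - a) * (j - i)  ≡⟨ solve 4 (λ a b i j → (b :- a) :* (j :- i) := (a :- b) :* (i :- j)) refl a b i j ⟩
    (a - b) * (i - j)  ∎

  β≡0⇒α≡1 : β ≡ 0 → α ≡ 1
  β≡0⇒α≡1 β≡0 = differ-≢ λ a≡b → s≢0 (begin
    s                  ≡⟨ β≡0⇒s≡[a-b][i-j] β≡0 ⟩
    (a - b) * (i - j)  ≡⟨ cong (λ t → (t - b) * (i - j)) (just-injective a≡b) ⟩
    (b - b) * (i - j)  ≡⟨ solve 3 (λ b i j → (b :- b) :* (i :- j) := :0) refl b i j ⟩
    0#                 ∎)

  balanced⇒two-agreements : q % 3 ≡ 1 → a ≢ b →
    r ≡ (a - b) * (i - j) → s ≡ (a - b) * (i - j) → count (agree? π σ) ≡ 2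
  balanced⇒two-agreements q%3≡1 a≢b r≡De s≡De =
    count≡2 (agree? π σ) u₁≢u₂ λ x →
      ⇔-trans (agree⇔root x) (⇔-trans (factor⇔ x) (root-of-product⇔ (x≢y⇒x-y≢0 a≢b)))
    where
    root = CubeRoots.cube-root-of-unity K q%3≡1
    ω = proj₁ root
    ω²+ω+1≡0 = proj₁ (proj₂ root)
    ω≢1 = proj₂ (proj₂ root)
    u₁ u₂ : F
    u₁ = i + (i - j) * ω
    u₂ = i + (i - j) * (ω * ω)

    -- with r = s = (a - b)(i - j) the agreement polynomial is (a - b)(y² + (i - j) y + (i - j)²), y = x - i
    factorisation : ∀ x → agreement-polynomial x ≡ (a - b) * ((x - u₁) * (x - u₂))
    factorisation x = begin
      agreement-polynomial x
        ≡⟨ cong₂ (λ r′ s′ → (a - b) * ((x - i) * (x - j)) + (r′ * (x - j) - s′ * (x - i))) r≡De s≡De ⟩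
      (a - b) * ((x - i) * (x - j)) + ((a - b) * (i - j) * (x - j) - (a - b) * (i - j) * (x - i))
        ≡⟨ solve 6 (λ a b i j x ω → let D = a :- b ; e = i :- j in
             D :* ((x :- i) :* (x :- j)) :+ (D :* e :* (x :- j) :- D :* e :* (x :- i))
             := D :* ((x :- (i :+ e :* ω)) :* (x :- (i :+ e :* (ω :* ω))))
                :+ D :* ((ω :* ω :+ ω :+ :1) :* (e :* (x :- i) :+ e :* e :* (:1 :- ω))))
             refl a b i j x ω ⟩
      (a - b) * ((x - u₁) * (x - u₂)) + (a - b) * ((ω * ω + ω + 1#) * remainder)
        ≡⟨ cong (λ t → (a - b) * ((x - u₁) * (x - u₂)) + (a - b) * (t * remainder)) ω²+ω+1≡0 ⟩
      (a - b) * ((x - u₁) * (x - u₂)) + (a - b) * (0# * remainder)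
        ≡⟨ solve 3 (λ P D T → P :+ D :* (:0 :* T) := P) refl _ (a - b) remainder ⟩
      (a - b) * ((x - u₁) * (x - u₂)) ∎
      where
      remainder = (i - j) * (x - i) + (i - j) * (i - j) * (1# - ω)

    factor⇔ : ∀ x → agreement-polynomial x ≡ 0# ⇔ (a - b) * ((x - u₁) * (x - u₂)) ≡ 0#
    factor⇔ x = mk⇔ (trans (sym (factorisation x))) (trans (factorisation x))

    ω≢0 : ω ≢ 0#
    ω≢0 ω≡0 = 1≢0 (begin
      1#                 ≡⟨ solve 0 (:1 := :0 :* :0 :+ :0 :+ :1) refl ⟩
      0# * 0# + 0# + 1#  ≡⟨ cong (λ t → t * t + t + 1#) ω≡0 ⟨
      ω * ω + ω + 1#     ≡⟨ ω²+ω+1≡0 ⟩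
      0#                 ∎)

    u₁≢u₂ : u₁ ≢ u₂
    u₁≢u₂ u₁≡u₂ = *-≢0 i-j≢0 (*-≢0 ω≢0 (x≢y⇒x-y≢0 (ω≢1 ∘ sym))) (begin
      (i - j) * (ω * (1# - ω))
        ≡⟨ solve 3 (λ i j ω → (i :- j) :* (ω :* (:1 :- ω)) := i :+ (i :- j) :* ω :- (i :+ (i :- j) :* (ω :* ω)))
             refl i j ω ⟩
      u₁ - u₂  ≡⟨ x≡y⇒x-y≡0 u₁≡u₂ ⟩
      0#       ∎)

  hd-drop⇒Edge : q % 3 ≡ 1 → hd (tri π) (tri σ) ℕ.+ 3 ≡ hd π σ → Edge π σ
  hd-drop⇒Edge q%3≡1 drop =
    frac∈PGL a r i r≢0 , frac∈PGL b s j s≢0 , (λ π≗σ → a≢b (just-injective (π≗σ ∞))) ,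
    Equivalence.from Edge-count⇔ (begin
      β ℕ.+ γ ℕ.+ 2            ≡⟨ cong₂ (λ m n → m ℕ.+ n ℕ.+ 2) β≡0 γ≡0 ⟩
      2
        ≡⟨ balanced⇒two-agreements q%3≡1 a≢b (γ≡0⇒r≡[a-b][i-j] γ≡0) (β≡0⇒s≡[a-b][i-j] β≡0) ⟨
      count (agree? π σ)       ∎)
    where
    β+γ+1≡α : β ℕ.+ γ ℕ.+ 1 ≡ α
    β+γ+1≡α = Equivalence.to hd-drop⇔ drop
    β≡0×γ≡0 = m+n+o≤o⇒m≡0×n≡0 β γ (subst (_≤ 1) (sym β+γ+1≡α) (differ≤1 _ _))
    β≡0 = proj₁ β≡0×γ≡0
    γ≡0 = proj₂ β≡0×γ≡0
    a≢b : a ≢ b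
    a≢b a≡b with trans (sym (β≡0⇒α≡1 β≡0)) (differ-≡ (cong just a≡b))
    ... | ()

  Edge⇒hd-drop : Edge π σ → hd (tri π) (tri σ) ℕ.+ 3 ≡ hd π σ
  Edge⇒hd-drop (_ , _ , _ , hd-tri+4≡q) = Equivalence.from hd-drop⇔ (begin
    β ℕ.+ γ ℕ.+ 1  ≡⟨ cong₂ (λ m n → m ℕ.+ n ℕ.+ 1) β≡0 γ≡0 ⟩
    1              ≡⟨ β≡0⇒α≡1 β≡0 ⟨
    α              ∎)
    where
    β≡0×γ≡0 = m+n+o≤o⇒m≡0×n≡0 β γ
      (subst (_≤ 2) (sym (Equivalence.to Edge-count⇔ hd-tri+4≡q)) agreements≤2)
    β≡0 = proj₁ β≡0×γ≡0
    γ≡0 = proj₂ β≡0×γ≡0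

open import Data.Nat using (_+_; _^_)

-- Only q ≡ 1 (mod 3) is used.
lemma11 : (p m q : ℕ) → Prime p → ¬ (p ≡ 2) → q ≡ p ^ m → q % 3 ≡ 1 → 13 ≤ q →
    (K : FiniteField q) →
    (a b i j r s : FiniteField.F K) →
    ¬ (r ≡ FiniteField.0# K) → ¬ (s ≡ FiniteField.0# K) →
    ((FiniteField.hd K (FiniteField.tri K (FiniteField.frac K a r i))
                       (FiniteField.tri K (FiniteField.frac K b s j)) + 3
        ≡ FiniteField.hd K (FiniteField.frac K a r i) (FiniteField.frac K b s j))
      ⇔ FiniteField.Edge K (FiniteField.frac K a r i) (FiniteField.frac K b s j))
lemma11 p m q _ _ _ q%3≡1 _ K a b i j r s r≢0 s≢0 with FiniteField._≟_ K i j
... | yes refl = mk⇔ (⊥-elim ∘ ¬hd-drop) (⊥-elim ∘ ¬Edge)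
  where open EqualPoles K a b i r s
... | no i≢j   = mk⇔ (hd-drop⇒Edge q%3≡1) Edge⇒hd-drop
  where open DistinctPoles K a b i j r s r≢0 s≢0 i≢j
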